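{- Let $m=2$. For every row $x\ge1$ and every column $c\in\{0,\dots,x-1\}$, define $c_x=c$ and, for $y\ge x$, $c_{y+1}=(c_y-2)\bmod y$ (the least nonnegative residue of $c_y-2$ modulo $y$). Then $c_y=0$ for infinitely many $y\ge x$. In words: every individual entry of $T_2$ appears at the head (column $0$) of infinitely many rows.
   Context: The triangle $T_m$ (rotation number $m$) is the array whose row $x$ has $x$ entries in columns $0,\dots,x-1$, defined by $T_m(1,0)=1$; for $x>1$ and $0\le c\le x-2$, $T_m(x,c)=T_m(x-1,c+m)$; and $T_m(x,x-1)=1+T_m(x-1,0)$, where $T_m(x,c)$ for any integer $c$ denotes the entry in row $x$, column ($c$ mod $x$). Each row is obtained from the previous one by cyclically rotating $m$ places to the left and appending $1$ plus the former head; the entry in column $c$ of row $y$ moves to column $(c-m)\bmod y$ of row $y+1$. -}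

module Defs where

open import Data.Nat using (ℕ; zero; suc; _+_)
open import Data.Integer using (ℤ; +_; _-_; _%ℕ_)

-- The row y is passed as suc y' so that y ≥ 1 holds definitionally.
step : (y' : ℕ) → ℕ → ℕ
step y' c = (+ c - + 2) %ℕ (suc y')

-- col x c k = c_{x+k}, where c_x = c and c_{y+1} = (c_y - 2) mod y.
-- Here x = suc x' (so x ≥ 1).
col : (x' : ℕ) → ℕ → ℕ → ℕ
col x' c zero    = c
col x' c (suc k) = step (x' + k) (col x' c k)

{-# OPTIONS --safe #-}
module Submission where

-- Below the diagonal a column just drops by 2 from one row to the next (c_y < y is
-- invariant), so every trajectory reaches 0 or 1. A 1 in row y wraps round to y − 1 and
-- descends again: for odd y it reaches 0, for even y it comes back to 1 in row 3y/2.
-- Each return removes one factor 2 from the row, so after finitely many returns the row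
-- is odd and the next visit is a 0. Restarting from any later row gives infinitely many.

open import Defs
open import Data.Nat using (ℕ; zero; suc; _+_; _*_; _^_; _<_; _≤_; s≤s)
open import Data.Nat.Properties
  using (+-suc; +-identityʳ; +-assoc; +-comm; *-identityˡ; *-assoc; suc-injective;
         ≤-trans; +-monoʳ-≤; n≤1+n; m≤m+n; m≤n+m; m+n≤o⇒n≤o; m≤m*n)
open import Data.Nat.DivMod using (m<n⇒m%n≡m)
open import Data.Nat.Induction using (<-rec)
open import Data.Nat.Tactic.RingSolver using (solve-∀; solve)
open import Data.Integer as ℤ using ()
open import Data.Integer.DivMod using (n%ℕd<d)
open import Data.List using (_∷_; [])
open import Data.Product using (∃-syntax; _×_; _,_)
open import Data.Sum using (_⊎_; inj₁; inj₂)
open import Relation.Binary.PropositionalEquality using (_≡_; refl; sym; trans; cong; subst)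
open import Relation.Binary.PropositionalEquality.Properties using (module ≡-Reasoning)

-- The remainder is written out as "+ 0" so that both cases feed C-descends directly.
halve : ∀ n → ∃[ j ] (n ≡ j * 2 + 0 ⊎ n ≡ j * 2 + 1)
halve zero = 0 , inj₁ refl
halve (suc zero) = 0 , inj₂ refl
halve (suc (suc n)) with halve n
... | j , inj₁ e = suc j , inj₁ (cong (2 +_) e)
... | j , inj₂ e = suc j , inj₂ (cong (2 +_) e)

OddPart : ℕ → Set
OddPart n = ∃[ a ] ∃[ o ] n ≡ 2 ^ a * suc (o * 2)

oddPart-suc : ∀ n → OddPart (suc n)
oddPart-suc = <-rec (λ n → OddPart (suc n)) factorise
  where
  factorise : ∀ n → (∀ {m} → m < n → OddPart (suc m)) → OddPart (suc n)
  factorise n rec with halve (suc n)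
  ... | j , inj₂ e = 0 , j , trans e (solve (j ∷ []))
  ... | suc j , inj₁ e with rec j<n
    where
    j<n : j < n
    j<n = subst (suc j ≤_) (sym (suc-injective e))
                (s≤s (≤-trans (m≤m*n j 2) (m≤m+n (j * 2) 0)))
  ... | a , o , e′ = suc a , o , (begin
    suc n                        ≡⟨ e ⟩
    suc j * 2 + 0                ≡⟨ +-identityʳ _ ⟩
    suc j * 2                    ≡⟨ cong (_* 2) e′ ⟩
    2 ^ a * suc (o * 2) * 2      ≡⟨ double-comm (2 ^ a) (suc (o * 2)) ⟩
    2 * 2 ^ a * suc (o * 2)      ∎)
    where
    open ≡-Reasoning
    double-comm : ∀ p q → p * q * 2 ≡ 2 * p * q
    double-comm = solve-∀

step-< : ∀ y′ c → step y′ c < suc y′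
step-< y′ c = n%ℕd<d (ℤ.+ c ℤ.- ℤ.+ 2) (suc y′)

step-2+ : ∀ y′ n → n < suc y′ → step y′ (2 + n) ≡ n
step-2+ y′ n n<y = m<n⇒m%n≡m n<y

step-1 : ∀ y′ → step y′ 1 ≡ y′
step-1 zero = refl
step-1 (suc y′) = refl

module Trajectory (x′ c : ℕ) (c<x : c < suc x′) where

  row : ℕ → ℕ
  row k = suc x′ + k

  C : ℕ → ℕ
  C = col x′ c

  C<row : ∀ k → C k < row k
  C<row zero = subst (λ y → c < suc y) (sym (+-identityʳ x′)) c<x
  C<row (suc k) = ≤-trans (step-< (x′ + k) (C k)) (s≤s (+-monoʳ-≤ x′ (n≤1+n k)))

  C-descends : ∀ j r k → C k ≡ j * 2 + r → C (j + k) ≡ r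
  C-descends zero r k e = e
  C-descends (suc j) r k e = subst (λ i → C i ≡ r) (+-suc j k) (C-descends j r (suc k) e′)
    where
    e′ : C (suc k) ≡ j * 2 + r
    e′ = begin
      step (x′ + k) (C k)             ≡⟨ cong (step (x′ + k)) e ⟩
      step (x′ + k) (2 + (j * 2 + r)) ≡⟨ step-2+ (x′ + k) _ (m+n≤o⇒n≤o 2 C<row′) ⟩
      j * 2 + r                       ∎
      where
      open ≡-Reasoning
      C<row′ : 2 + (j * 2 + r) < row k
      C<row′ = subst (_< row k) e (C<row k)

  HitsZeroAfter : ℕ → Set
  HitsZeroAfter k = ∃[ k′ ] k ≤ k′ × C k′ ≡ 0

  hitsZeroAfter-anti : ∀ {k l} → k ≤ l → HitsZeroAfter l → HitsZeroAfter k
  hitsZeroAfter-anti k≤l (k′ , l≤k′ , z) = k′ , ≤-trans k≤l l≤k′ , z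

  C-after-one : ∀ k → C k ≡ 1 → C (suc k) ≡ x′ + k
  C-after-one k e = trans (cong (step (x′ + k)) e) (step-1 (x′ + k))

  row-+ : ∀ m k → row (m + k) ≡ row k + m
  row-+ m k = trans (cong (suc x′ +_) (+-comm m k)) (sym (+-assoc (suc x′) k m))

  one-at-odd-row : ∀ k o → C k ≡ 1 → row k ≡ suc (o * 2) → C (o + suc k) ≡ 0
  one-at-odd-row k o e r =
    C-descends o 0 (suc k)
      (trans (C-after-one k e) (trans (suc-injective r) (sym (+-identityʳ _))))

  one-at-even-row : ∀ k m → C k ≡ 1 → row k ≡ 2 * m →
                    C (m + k) ≡ 1 × row (m + k) ≡ 3 * m
  one-at-even-row k zero e ()
  one-at-even-row k (suc m) e r = subst (λ i → C i ≡ 1) (+-suc m k) C≡1 , row≡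
    where
    open ≡-Reasoning
    C≡1 : C (m + suc k) ≡ 1
    C≡1 = C-descends m 1 (suc k) (begin
      C (suc k)         ≡⟨ C-after-one k e ⟩
      x′ + k            ≡⟨ suc-injective r ⟩
      m + suc (m + 0)   ≡⟨ solve (m ∷ []) ⟩
      m * 2 + 1         ∎)
    row≡ : row (suc m + k) ≡ 3 * suc m
    row≡ = begin
      row (suc m + k)   ≡⟨ row-+ (suc m) k ⟩
      row k + suc m     ≡⟨ cong (_+ suc m) r ⟩
      2 * suc m + suc m ≡⟨ solve (m ∷ []) ⟩
      3 * suc m         ∎

  one-hits-zero : ∀ a o k → C k ≡ 1 → row k ≡ 2 ^ a * suc (o * 2) → HitsZeroAfter k
  one-hits-zero zero o k e r =
    o + suc k , ≤-trans (n≤1+n k) (m≤n+m (suc k) o) ,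
    one-at-odd-row k o e (trans r (*-identityˡ _))
  one-hits-zero (suc a) o k e r
    with one-at-even-row k (2 ^ a * suc (o * 2)) e (trans r (*-assoc 2 (2 ^ a) _))
  ... | C≡1 , row≡ = hitsZeroAfter-anti (m≤n+m k _)
    (one-hits-zero a (suc (o * 3)) _ C≡1 (trans row≡ (thrice-odd (2 ^ a) o)))
    where
    thrice-odd : ∀ p o → 3 * (p * suc (o * 2)) ≡ p * suc (suc (o * 3) * 2)
    thrice-odd = solve-∀

  hitsZeroAfter : ∀ k → HitsZeroAfter k
  hitsZeroAfter k with halve (C k)
  ... | j , inj₁ e = j + k , m≤n+m k j , C-descends j 0 k e
  ... | j , inj₂ e with oddPart-suc (x′ + (j + k))
  ... | a , o , r =
    hitsZeroAfter-anti (m≤n+m k j) (one-hits-zero a o (j + k) (C-descends j 1 k e) r)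

theorem3 : (x' c : ℕ) → c < suc x' →
    (N : ℕ) → ∃[ k ] (N ≤ suc x' + k × col x' c k ≡ 0)
theorem3 x' c c<x N with Trajectory.hitsZeroAfter x' c c<x N
... | k , N≤k , hit = k , ≤-trans N≤k (m≤n+m k (suc x')) , hit
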